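{- Consider an instance of the a priori traveling repairman problem with uniform activation probability $p$ on a vertex set $\bigcup_{v\in X}S_v$, where for each $v\in X$ the vertices of $S_v$ are co-located (at mutual distance $0$). Let $\tau$ be a master tour, fix $z\in X$, and let $C_z^1,\dots,C_z^k$ be the minimal partition of $S_z$ such that the vertices of each $C_z^\ell$ appear consecutively in $\tau$. For two parts $C_z^i$ and $C_z^j$ with $i\ne j$, let $\tau_i$ be the tour obtained from $\tau$ by relocating the vertices of $C_z^j$ to immediately after $C_z^i$, and let $\tau_j$ be the tour obtained from $\tau$ by relocating the vertices of $C_z^i$ to immediately before $C_z^j$. Then $$\mathbb{E}_A\big[\mathsf{LAT}^A_\tau\big]\ge\min\Big(\mathbb{E}_A\big[\mathsf{LAT}^A_{\tau_i}\big],\,\mathbb{E}_A\big[\mathsf{LAT}^A_{\tau_j}\big]\Big).$$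
   Context: The random active set $A$ contains each vertex independently with probability $p$. A master tour $\tau$ starts at the root $r$ and visits all vertices; $\tau_A$ visits the vertices of $A$ in the order of $\tau$ (shortcutting others), starting at $r$. For $v\in A$, $\mathsf{LAT}^A_\tau(v)$ is the length of the path along $\tau_A$ from $r$ to $v$, and $\mathsf{LAT}^A_\tau=\sum_{v\in A}\mathsf{LAT}^A_\tau(v)$.
   Formalization: The activation probability $p$ and the distances between locations take rational values. -}

module Defs where

open import Data.Nat using (ℕ; zero; suc)
open import Data.Fin using (Fin)
open import Data.Bool using (Bool; true; false; if_then_else_)
open import Data.Vec using (Vec; []; _∷_; lookup)
open import Data.List using (List; []; _∷_; _++_; [_]; map; filterᵇ; concatMap; foldr)
open import Data.List.Relation.Unary.All using (All)
open import Data.Product using (Σ; ∃; _×_; _,_)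
open import Data.Sum using (_⊎_)
open import Data.Rational using (ℚ; 0ℚ; 1ℚ; _+_; _*_; _-_; _≤_)
open import Relation.Binary.PropositionalEquality using (_≡_; _≢_)

_^ℚ_ : ℚ → ℕ → ℚ
q ^ℚ zero  = 1ℚ
q ^ℚ suc k = q * (q ^ℚ k)

sumℚ : List ℚ → ℚ
sumℚ = foldr _+_ 0ℚ

allSubsets : (n : ℕ) → List (Vec Bool n)
allSubsets zero    = [] ∷ []
allSubsets (suc n) = concatMap (λ A → (true ∷ A) ∷ (false ∷ A) ∷ []) (allSubsets n)

probSubset : ∀ {n} → ℚ → Vec Bool n → ℚ
probSubset p []           = 1ℚ
probSubset p (true  ∷ A)  = p * probSubset p A
probSubset p (false ∷ A)  = (1ℚ - p) * probSubset p A

record IsMetric {m : ℕ} (d : Fin m → Fin m → ℚ) : Set where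
  field
    nonneg : ∀ x y → 0ℚ ≤ d x y
    refl0  : ∀ x → d x x ≡ 0ℚ
    sym    : ∀ x y → d x y ≡ d y x
    tri    : ∀ x y w → d x w ≤ d x y + d y w

module Instance {m n : ℕ} (d : Fin m → Fin m → ℚ) (loc : Fin n → Fin m) (r : Fin m) where

  -- sum over the visited vertices of their arrival times; t = time so far, cur = current location
  latFrom : ℚ → Fin m → List (Fin n) → ℚ
  latFrom t cur []       = 0ℚ
  latFrom t cur (v ∷ vs) = (t + d cur (loc v)) + latFrom (t + d cur (loc v)) (loc v) vs

  -- LAT^A_τ : total latency of τ_A (τ shortcut to A), starting at the root
  LAT : Vec Bool n → List (Fin n) → ℚ
  LAT A τ = latFrom 0ℚ r (filterᵇ (λ v → lookup A v) τ)

  ELAT : ℚ → List (Fin n) → ℚ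
  ELAT p τ = sumℚ (map (λ A → probSubset p A * LAT A τ) (allSubsets n))

  NotEndsIn : Fin m → List (Fin n) → Set
  NotEndsIn z pre = pre ≡ [] ⊎ Σ (List (Fin n)) λ a → Σ (Fin n) λ x → pre ≡ a ++ [ x ] × loc x ≢ z

  NotStartsIn : Fin m → List (Fin n) → Set
  NotStartsIn z post = post ≡ [] ⊎ Σ (Fin n) λ x → Σ (List (Fin n)) λ b → post ≡ x ∷ b × loc x ≢ z

  -- C is a part of the minimal partition of S_z into τ-consecutive blocks
  -- (i.e. a maximal run of S_z-vertices in τ), occurring as τ = pre ++ C ++ post
  MaxRun : Fin m → List (Fin n) → List (Fin n) → List (Fin n) → List (Fin n) → Set
  MaxRun z τ pre C post =
    τ ≡ pre ++ C ++ post × C ≢ [] × All (λ v → loc v ≡ z) C × NotEndsIn z pre × NotStartsIn z post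

  -- τi : move C_j to right after C_i;  τj : move C_i to right before C_j   (C_i, C_j distinct parts)
  Relocations : Fin m → List (Fin n) → List (Fin n) → List (Fin n) → Set
  Relocations z τ τi τj =
    Σ (List (Fin n)) λ a → Σ (List (Fin n)) λ b → Σ (List (Fin n)) λ c →
    Σ (List (Fin n)) λ Ci → Σ (List (Fin n)) λ Cj →
      ( MaxRun z τ a Ci (b ++ Cj ++ c) × MaxRun z τ (a ++ Ci ++ b) Cj c
        × τi ≡ a ++ Ci ++ Cj ++ b ++ c × τj ≡ a ++ b ++ Ci ++ Cj ++ c )
      ⊎
      ( MaxRun z τ a Cj (b ++ Ci ++ c) × MaxRun z τ (a ++ Cj ++ b) Ci c
        × τi ≡ a ++ b ++ Ci ++ Cj ++ c × τj ≡ a ++ Ci ++ Cj ++ b ++ c )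

{-# OPTIONS --safe #-}
module Submission where

-- Condition on the coins of all vertices outside C₁ ∪ C₂. As each block is co-located at z,
-- the latency of each of the three tours is then a polynomial (twoBlockLatency) in the number
-- of active vertices of each block and in the indicators that a block has an active vertex,
-- with coefficients depending only on the other coins. Averaging over the independent coins of
-- a block C replaces these by p∣C∣ and 1 - (1-p)^∣C∣. In
--   (∣C₁∣ + ∣C₂∣) E[LAT τ] - ∣C₁∣ E[LAT τ₁] - ∣C₂∣ E[LAT τ₂],
-- τ₁ and τ₂ being the two relocations, the terms in p∣C∣ cancel and what remains is a
-- combination of detour costs, which are nonnegative by the triangle inequality, with weights
-- that are nonnegative since k₁ (1 - (1-p)^k₂) (1-p)^k₁ ≤ k₂ (1 - (1-p)^k₁). So a weighted
-- mean of the relocated tours, and hence their minimum, is at most E[LAT τ].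

open import Defs
open import Data.Nat using (ℕ; suc)
open import Data.Fin using (Fin; zero; suc)
open import Data.List using (List; allFin; []; _∷_; _++_; map; filterᵇ; concatMap)
open import Data.List.Relation.Binary.Permutation.Propositional as ↭ using (_↭_; ↭-sym; ↭⇒↭ₛ; module PermutationReasoning)
open import Data.Rational using (ℚ; 0ℚ; 1ℚ; _≤_; _⊓_; _+_; _*_; _-_; -_; _<_; nonNegative; positive)

open import Data.Bool using (Bool; true; false)
open import Data.Vec using (Vec; []; _∷_; lookup; _[_]≔_)
open import Data.Vec.Properties using ([]≔-commutes; lookup∘update; lookup∘update′)
open import Data.List.Properties using (++-assoc; filter-++)
open import Data.List.Membership.Propositional using (_∈_; _∉_)
open import Data.List.Membership.Propositional.Properties using (∈-++⁺ˡ; ∈-++⁺ʳ)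
open import Data.List.Relation.Unary.Any using (here; there)
open import Data.List.Relation.Unary.All using (All; []; _∷_)
import Data.List.Relation.Unary.All.Properties as All
open import Data.List.Relation.Unary.AllPairs using ([]; _∷_)
open import Data.List.Relation.Unary.Unique.Propositional using (Unique)
open import Data.List.Relation.Unary.Unique.Propositional.Properties using (allFin⁺)
open import Data.List.Relation.Binary.Subset.Propositional using (_⊆_)
open import Data.List.Relation.Binary.Disjoint.Propositional using (Disjoint)
open import Data.List.Relation.Binary.Disjoint.Propositional.Properties using () renaming (sym to Disjoint-sym)
open import Data.List.Relation.Binary.Permutation.Propositional.Properties using (shifts; ++⁺ˡ; ++-comm; All-resp-↭)
open import Data.List.Relation.Binary.Permutation.Setoid.Properties using (Unique-resp-↭)
open import Data.Rational.Properties
open import Data.Product using (_×_; _,_; proj₁; proj₂)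
open import Data.Sum using (inj₁; inj₂)
open import Data.Empty using (⊥-elim)
open import Function using (_∘_; id)
open import Level using (0ℓ)
open import Relation.Nullary.Decidable using (T?; dec⇒maybe)
open import Relation.Binary.PropositionalEquality
open import Tactic.RingSolver using (solve-∀)
open import Tactic.RingSolver.Core.AlmostCommutativeRing using (AlmostCommutativeRing; fromCommutativeRing)

ℚ-ring : AlmostCommutativeRing 0ℓ 0ℓ
ℚ-ring = fromCommutativeRing +-*-commutativeRing (λ x → dec⇒maybe (0ℚ ≟ x))

+-pres-0≤ : ∀ {x y} → 0ℚ ≤ x → 0ℚ ≤ y → 0ℚ ≤ x + y
+-pres-0≤ = +-mono-≤

*-pres-0≤ : ∀ {x y} → 0ℚ ≤ x → 0ℚ ≤ y → 0ℚ ≤ x * y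
*-pres-0≤ {x} {y} 0≤x 0≤y =
  nonNegative⁻¹ (x * y) {{nonNeg*nonNeg⇒nonNeg x {{nonNegative 0≤x}} y {{nonNegative 0≤y}}}}

p≤q⇒0≤q-p : ∀ {p q} → p ≤ q → 0ℚ ≤ q - p
p≤q⇒0≤q-p {p} {q} p≤q = subst (_≤ q - p) (+-inverseʳ p) (+-monoˡ-≤ (- p) p≤q)

0≤q-p⇒p≤q : ∀ {p q} → 0ℚ ≤ q - p → p ≤ q
0≤q-p⇒p≤q {p} {q} 0≤q-p = subst₂ _≤_ (+-identityʳ p) (cancel p q) (+-monoʳ-≤ p 0≤q-p)
  where
  cancel : ∀ p q → p + (q - p) ≡ q
  cancel = solve-∀ ℚ-ring

0≤1 : 0ℚ ≤ 1ℚ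
0≤1 = <⇒≤ (positive⁻¹ 1ℚ)

weighted-mean⇒⊓≤ : ∀ {s₁ s₂ x y e} → 0ℚ ≤ s₁ → 0ℚ ≤ s₂ → 0ℚ < s₁ + s₂ →
                   s₁ * x + s₂ * y ≤ (s₁ + s₂) * e → x ⊓ y ≤ e
weighted-mean⇒⊓≤ {s₁} {s₂} {x} {y} {e} 0≤s₁ 0≤s₂ 0<s mean≤ = *-cancelˡ-≤-pos (s₁ + s₂) {{positive 0<s}} (begin
  (s₁ + s₂) * (x ⊓ y)          ≡⟨ *-distribʳ-+ (x ⊓ y) s₁ s₂ ⟩
  s₁ * (x ⊓ y) + s₂ * (x ⊓ y)  ≤⟨ +-mono-≤ (*-monoˡ-≤-nonNeg s₁ {{nonNegative 0≤s₁}} (p⊓q≤p x y))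
                                            (*-monoˡ-≤-nonNeg s₂ {{nonNegative 0≤s₂}} (p⊓q≤q x y)) ⟩
  s₁ * x + s₂ * y              ≤⟨ mean≤ ⟩
  (s₁ + s₂) * e                ∎)
  where open ≤-Reasoning

lengthℚ : ∀ {A : Set} → List A → ℚ
lengthℚ []       = 0ℚ
lengthℚ (_ ∷ xs) = 1ℚ + lengthℚ xs

nonEmptyℚ : ∀ {A : Set} → List A → ℚ
nonEmptyℚ []      = 0ℚ
nonEmptyℚ (_ ∷ _) = 1ℚ

lengthℚ-nonNeg : ∀ {A : Set} (xs : List A) → 0ℚ ≤ lengthℚ xs
lengthℚ-nonNeg []       = ≤-refl
lengthℚ-nonNeg (_ ∷ xs) = +-pres-0≤ 0≤1 (lengthℚ-nonNeg xs)

lengthℚ-pos : ∀ {A : Set} (xs : List A) → xs ≢ [] → 0ℚ < lengthℚ xs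
lengthℚ-pos []       xs≢[] = ⊥-elim (xs≢[] refl)
lengthℚ-pos (_ ∷ xs) _     = +-mono-<-≤ (positive⁻¹ 1ℚ) (lengthℚ-nonNeg xs)

lengthℚ-++ : ∀ {A : Set} (xs ys : List A) → lengthℚ (xs ++ ys) ≡ lengthℚ xs + lengthℚ ys
lengthℚ-++ []       ys = sym (+-identityˡ (lengthℚ ys))
lengthℚ-++ (_ ∷ xs) ys = trans (cong (1ℚ +_) (lengthℚ-++ xs ys)) (sym (+-assoc 1ℚ (lengthℚ xs) (lengthℚ ys)))

nonEmptyℚ-nonNeg : ∀ {A : Set} (xs : List A) → 0ℚ ≤ nonEmptyℚ xs
nonEmptyℚ-nonNeg []      = ≤-refl
nonEmptyℚ-nonNeg (_ ∷ _) = 0≤1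

active : ∀ {n} → Vec Bool n → List (Fin n) → List (Fin n)
active A = filterᵇ (lookup A)

active-++ : ∀ {n} (A : Vec Bool n) xs ys → active A (xs ++ ys) ≡ active A xs ++ active A ys
active-++ A = filter-++ (T? ∘ lookup A)

active-update : ∀ {n} {v : Fin n} xs b A → v ∉ xs → active (A [ v ]≔ b) xs ≡ active A xs
active-update []       b A v∉xs = refl
active-update (x ∷ xs) b A v∉xs
  rewrite lookup∘update′ (λ x≡v → v∉xs (here (sym x≡v))) A b
  with lookup A x
... | true  = cong (x ∷_) (active-update xs b A (v∉xs ∘ there))
... | false = active-update xs b A (v∉xs ∘ there)

active-set-true : ∀ {n} (v : Fin n) xs A → v ∉ xs → active (A [ v ]≔ true) (v ∷ xs) ≡ v ∷ active A xs
active-set-true v xs A v∉xs rewrite lookup∘update v A true = cong (v ∷_) (active-update xs true A v∉xs)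

active-set-false : ∀ {n} (v : Fin n) xs A → v ∉ xs → active (A [ v ]≔ false) (v ∷ xs) ≡ active A xs
active-set-false v xs A v∉xs rewrite lookup∘update v A false = active-update xs false A v∉xs

Invariant : ∀ {n} {X : Set} → List (Fin n) → (Vec Bool n → X) → Set
Invariant L f = ∀ {v} → v ∈ L → ∀ b A → f (A [ v ]≔ b) ≡ f A

Invariant-map : ∀ {n} {X Y : Set} {L : List (Fin n)} {f : Vec Bool n → X} (h : X → Y) →
                Invariant L f → Invariant L (h ∘ f)
Invariant-map h f-inv v∈L b A = cong h (f-inv v∈L b A)

Invariant-map₂ : ∀ {n} {X Y Z : Set} {L : List (Fin n)} {f : Vec Bool n → X} {g : Vec Bool n → Y}
                 (h : X → Y → Z) → Invariant L f → Invariant L g → Invariant L (λ A → h (f A) (g A))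
Invariant-map₂ h f-inv g-inv v∈L b A = cong₂ h (f-inv v∈L b A) (g-inv v∈L b A)

active-invariant : ∀ {n} {L xs : List (Fin n)} → Disjoint L xs → Invariant L (λ A → active A xs)
active-invariant {xs = xs} L#xs v∈L b A = active-update xs b A (λ v∈xs → L#xs (v∈L , v∈xs))

Unique-++⁻ : ∀ {A : Set} (xs : List A) {ys} → Unique (xs ++ ys) → Unique xs × Unique ys × Disjoint xs ys
Unique-++⁻ []       u = [] , u , λ ()
Unique-++⁻ (x ∷ xs) {ys} (x∉xs++ys ∷ u) with Unique-++⁻ xs u
... | u-xs , u-ys , xs#ys = All.++⁻ˡ xs x∉xs++ys ∷ u-xs , u-ys , disjoint
  where
  disjoint : Disjoint (x ∷ xs) ys
  disjoint (here refl , y∈ys) = All.All¬⇒¬Any (All.++⁻ʳ xs x∉xs++ys) y∈ys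
  disjoint (there v∈xs , v∈ys) = xs#ys (v∈xs , v∈ys)

↭allFin⇒Unique : ∀ {n} {τ : List (Fin n)} → τ ↭ allFin n → Unique τ
↭allFin⇒Unique τ↭ = Unique-resp-↭ (setoid (Fin _)) (↭⇒↭ₛ (↭-sym τ↭)) (allFin⁺ _)

module Averaging (p : ℚ) where

  weightedSum : ∀ {k} → List (Vec Bool k) → (Vec Bool k → ℚ) → ℚ
  weightedSum As f = sumℚ (map (λ A → probSubset p A * f A) As)

  𝔼 : ∀ {k} → (Vec Bool k → ℚ) → ℚ
  𝔼 {k} = weightedSum (allSubsets k)

  weightedSum-cong : ∀ {k} (As : List (Vec Bool k)) {f g} → (∀ A → f A ≡ g A) → weightedSum As f ≡ weightedSum As g
  weightedSum-cong []       f≗g = refl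
  weightedSum-cong (A ∷ As) f≗g = cong₂ (λ x y → probSubset p A * x + y) (f≗g A) (weightedSum-cong As f≗g)

  weightedSum-+ : ∀ {k} (As : List (Vec Bool k)) f g →
                  weightedSum As (λ A → f A + g A) ≡ weightedSum As f + weightedSum As g
  weightedSum-+ []       f g = refl
  weightedSum-+ (A ∷ As) f g rewrite weightedSum-+ As f g = distrib (probSubset p A) (f A) (g A) _ _
    where
    distrib : ∀ π x y u v → π * (x + y) + (u + v) ≡ (π * x + u) + (π * y + v)
    distrib = solve-∀ ℚ-ring

  weightedSum-minus : ∀ {k} (As : List (Vec Bool k)) f g →
                  weightedSum As (λ A → f A - g A) ≡ weightedSum As f - weightedSum As g
  weightedSum-minus []       f g = refl
  weightedSum-minus (A ∷ As) f g rewrite weightedSum-minus As f g = distrib (probSubset p A) (f A) (g A) _ _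
    where
    distrib : ∀ π x y u v → π * (x - y) + (u - v) ≡ (π * x + u) - (π * y + v)
    distrib = solve-∀ ℚ-ring

  weightedSum-*ˡ : ∀ {k} (As : List (Vec Bool k)) c f → weightedSum As (λ A → c * f A) ≡ c * weightedSum As f
  weightedSum-*ˡ []       c f = sym (*-zeroʳ c)
  weightedSum-*ˡ (A ∷ As) c f rewrite weightedSum-*ˡ As c f = distrib (probSubset p A) c (f A) _
    where
    distrib : ∀ π c x u → π * (c * x) + c * u ≡ c * (π * x + u)
    distrib = solve-∀ ℚ-ring

  weightedSum-extend : ∀ {k} (As : List (Vec Bool k)) (f : Vec Bool (suc k) → ℚ) →
    weightedSum (concatMap (λ A → (true ∷ A) ∷ (false ∷ A) ∷ []) As) f
      ≡ weightedSum As (λ A → p * f (true ∷ A) + (1ℚ - p) * f (false ∷ A))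
  weightedSum-extend []       f = refl
  weightedSum-extend (A ∷ As) f rewrite weightedSum-extend As f =
    distrib p (probSubset p A) (f (true ∷ A)) (f (false ∷ A)) _
    where
    distrib : ∀ p π x y u → (p * π) * x + (((1ℚ - p) * π) * y + u) ≡ π * (p * x + (1ℚ - p) * y) + u
    distrib = solve-∀ ℚ-ring

  averageAt : ∀ {k} → Fin k → (Vec Bool k → ℚ) → Vec Bool k → ℚ
  averageAt v f A = p * f (A [ v ]≔ true) + (1ℚ - p) * f (A [ v ]≔ false)

  𝔼-averageAt : ∀ {k} (v : Fin k) f → 𝔼 f ≡ 𝔼 (averageAt v f)
  𝔼-averageAt {suc k} zero f = begin
    𝔼 f                                      ≡⟨ weightedSum-extend (allSubsets k) f ⟩
    𝔼 w                                      ≡⟨ weightedSum-cong (allSubsets k) (λ A → idempotent p (w A)) ⟩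
    𝔼 (λ A → p * w A + (1ℚ - p) * w A)       ≡⟨ weightedSum-extend (allSubsets k) (averageAt zero f) ⟨
    𝔼 (averageAt zero f)                     ∎
    where
    open ≡-Reasoning
    w : Vec Bool k → ℚ
    w A = p * f (true ∷ A) + (1ℚ - p) * f (false ∷ A)
    idempotent : ∀ p x → x ≡ p * x + (1ℚ - p) * x
    idempotent = solve-∀ ℚ-ring
  𝔼-averageAt {suc k} (suc v) f = begin
    𝔼 f                                       ≡⟨ weightedSum-extend (allSubsets k) f ⟩
    𝔼 (λ A → p * fᵗ A + (1ℚ - p) * fᶠ A)       ≡⟨ mix fᵗ fᶠ ⟩
    p * 𝔼 fᵗ + (1ℚ - p) * 𝔼 fᶠ                 ≡⟨ cong₂ (λ x y → p * x + (1ℚ - p) * y) (𝔼-averageAt v fᵗ) (𝔼-averageAt v fᶠ) ⟩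
    p * 𝔼 (averageAt v fᵗ) + (1ℚ - p) * 𝔼 (averageAt v fᶠ)
                                              ≡⟨ mix (averageAt v fᵗ) (averageAt v fᶠ) ⟨
    𝔼 (λ A → p * averageAt v fᵗ A + (1ℚ - p) * averageAt v fᶠ A)
                                              ≡⟨ weightedSum-extend (allSubsets k) (averageAt (suc v) f) ⟨
    𝔼 (averageAt (suc v) f)                   ∎
    where
    open ≡-Reasoning
    fᵗ fᶠ : Vec Bool k → ℚ
    fᵗ A = f (true ∷ A)
    fᶠ A = f (false ∷ A)
    mix : ∀ g h → 𝔼 (λ A → p * g A + (1ℚ - p) * h A) ≡ p * 𝔼 g + (1ℚ - p) * 𝔼 h
    mix g h = trans (weightedSum-+ (allSubsets k) _ _)
                (cong₂ _+_ (weightedSum-*ˡ (allSubsets k) p g) (weightedSum-*ˡ (allSubsets k) (1ℚ - p) h))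

  -- average L f A is the conditional expectation of f given that the coordinates outside L
  -- agree with A.
  average : ∀ {k} → List (Fin k) → (Vec Bool k → ℚ) → Vec Bool k → ℚ
  average []      f = f
  average (v ∷ L) f = averageAt v (average L f)

  𝔼-average : ∀ {k} (L : List (Fin k)) f → 𝔼 f ≡ 𝔼 (average L f)
  𝔼-average []      f = refl
  𝔼-average (v ∷ L) f = trans (𝔼-average L f) (𝔼-averageAt v (average L f))

  average-cong : ∀ {k} (L : List (Fin k)) {f g} → (∀ A → f A ≡ g A) → ∀ A → average L f A ≡ average L g A
  average-cong []      f≗g = f≗g
  average-cong (v ∷ L) f≗g A =
    cong₂ (λ x y → p * x + (1ℚ - p) * y) (average-cong L f≗g _) (average-cong L f≗g _)

  average-++ : ∀ {k} (L₁ L₂ : List (Fin k)) f A → average (L₁ ++ L₂) f A ≡ average L₁ (average L₂ f) A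
  average-++ []       L₂ f A = refl
  average-++ (v ∷ L₁) L₂ f A =
    cong₂ (λ x y → p * x + (1ℚ - p) * y) (average-++ L₁ L₂ f _) (average-++ L₁ L₂ f _)

  average-update : ∀ {k} (L : List (Fin k)) {v} b f A → v ∉ L →
                   average L (λ B → f (B [ v ]≔ b)) A ≡ average L f (A [ v ]≔ b)
  average-update []      b f A v∉L = refl
  average-update (u ∷ L) {v} b f A v∉L =
    cong₂ (λ x y → p * x + (1ℚ - p) * y) (commute true) (commute false)
    where
    commute : ∀ b′ → average L (λ B → f (B [ v ]≔ b)) (A [ u ]≔ b′) ≡ average L f ((A [ v ]≔ b) [ u ]≔ b′)
    commute b′ = trans (average-update L b f (A [ u ]≔ b′) (v∉L ∘ there))
                       (cong (average L f) ([]≔-commutes A u v (λ u≡v → v∉L (here (sym u≡v)))))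

  average-minus : ∀ {k} (L : List (Fin k)) f g A → average L (λ B → f B - g B) A ≡ average L f A - average L g A
  average-minus []      f g A = refl
  average-minus (v ∷ L) f g A
    rewrite average-minus L f g (A [ v ]≔ true) | average-minus L f g (A [ v ]≔ false) = distrib p _ _ _ _
    where
    distrib : ∀ p x y u w → p * (x - y) + (1ℚ - p) * (u - w) ≡ (p * x + (1ℚ - p) * u) - (p * y + (1ℚ - p) * w)
    distrib = solve-∀ ℚ-ring

  average-*ˡ : ∀ {k} (L : List (Fin k)) {κ} f → Invariant L κ → ∀ A →
               average L (λ B → κ B * f B) A ≡ κ A * average L f A
  average-*ˡ []      f κ-inv A = refl
  average-*ˡ (v ∷ L) {κ} f κ-inv A
    rewrite average-*ˡ L f (κ-inv ∘ there) (A [ v ]≔ true) | average-*ˡ L f (κ-inv ∘ there) (A [ v ]≔ false)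
          | κ-inv (here refl) true A | κ-inv (here refl) false A = distrib p (κ A) _ _
    where
    distrib : ∀ p c x y → p * (c * x) + (1ℚ - p) * (c * y) ≡ c * (p * x + (1ℚ - p) * y)
    distrib = solve-∀ ℚ-ring

  miss : ∀ {A : Set} → List A → ℚ
  miss []       = 1ℚ
  miss (_ ∷ xs) = (1ℚ - p) * miss xs

  hit : ∀ {A : Set} → List A → ℚ
  hit xs = 1ℚ - miss xs

  miss-++ : ∀ {A : Set} (xs ys : List A) → miss (xs ++ ys) ≡ miss xs * miss ys
  miss-++ []       ys = sym (*-identityˡ (miss ys))
  miss-++ (_ ∷ xs) ys = trans (cong ((1ℚ - p) *_) (miss-++ xs ys)) (sym (*-assoc (1ℚ - p) (miss xs) (miss ys)))

  average-affine : ∀ {k} (L : List (Fin k)) {f α β γ} → Unique L →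
    Invariant L α → Invariant L β → Invariant L γ →
    (∀ B → f B ≡ α B + lengthℚ (active B L) * β B + nonEmptyℚ (active B L) * γ B) →
    ∀ A → average L f A ≡ α A + (p * lengthℚ L) * β A + hit L * γ A
  average-affine [] {f} {α} {β} {γ} _ _ _ _ f≡ A = trans (f≡ A) (empty p (α A) (β A) (γ A))
    where
    empty : ∀ p a b c → a + 0ℚ * b + 0ℚ * c ≡ a + (p * 0ℚ) * b + (1ℚ - 1ℚ) * c
    empty = solve-∀ ℚ-ring
  average-affine {k} (v ∷ L) {f} {α} {β} {γ} (v∉L ∷ uL) α-inv β-inv γ-inv f≡ A =
    trans (cong₂ (λ x y → p * x + (1ℚ - p) * y) on-true on-false)
          (combine p (α A) (β A) (γ A) (lengthℚ L) (miss L))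
    where
    v∉L′ : v ∉ L
    v∉L′ = All.All¬⇒¬Any v∉L
    α′ : Vec Bool k → ℚ
    α′ B = α B + β B + γ B
    f-true : ∀ B → f (B [ v ]≔ true) ≡ α′ B + lengthℚ (active B L) * β B + nonEmptyℚ (active B L) * 0ℚ
    f-true B rewrite f≡ (B [ v ]≔ true) | active-set-true v L B v∉L′
                   | α-inv (here refl) true B | β-inv (here refl) true B | γ-inv (here refl) true B =
      set (α B) (β B) (γ B) (lengthℚ (active B L)) (nonEmptyℚ (active B L))
      where
      set : ∀ a b c ℓ e → a + (1ℚ + ℓ) * b + 1ℚ * c ≡ (a + b + c) + ℓ * b + e * 0ℚ
      set = solve-∀ ℚ-ring
    f-false : ∀ B → f (B [ v ]≔ false) ≡ α B + lengthℚ (active B L) * β B + nonEmptyℚ (active B L) * γ B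
    f-false B rewrite f≡ (B [ v ]≔ false) | active-set-false v L B v∉L′
                    | α-inv (here refl) false B | β-inv (here refl) false B | γ-inv (here refl) false B = refl
    α′-inv : Invariant L α′
    α′-inv w∈L b B = cong₂ _+_ (cong₂ _+_ (α-inv (there w∈L) b B) (β-inv (there w∈L) b B)) (γ-inv (there w∈L) b B)
    on-true : average L f (A [ v ]≔ true) ≡ α′ A + (p * lengthℚ L) * β A + hit L * 0ℚ
    on-true = trans (sym (average-update L true f A v∉L′))
                    (average-affine L uL α′-inv (β-inv ∘ there) (λ _ _ _ → refl) f-true A)
    on-false : average L f (A [ v ]≔ false) ≡ α A + (p * lengthℚ L) * β A + hit L * γ A
    on-false = trans (sym (average-update L false f A v∉L′))
                     (average-affine L uL (α-inv ∘ there) (β-inv ∘ there) (γ-inv ∘ there) f-false A)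
    combine : ∀ p a b c ℓ m →
      p * ((a + b + c) + (p * ℓ) * b + (1ℚ - m) * 0ℚ) + (1ℚ - p) * (a + (p * ℓ) * b + (1ℚ - m) * c)
        ≡ a + (p * (1ℚ + ℓ)) * b + (1ℚ - (1ℚ - p) * m) * c
    combine = solve-∀ ℚ-ring

  module _ (0≤p : 0ℚ ≤ p) (p≤1 : p ≤ 1ℚ) where

    0≤1-p : 0ℚ ≤ 1ℚ - p
    0≤1-p = p≤q⇒0≤q-p p≤1

    probSubset-nonNeg : ∀ {k} (A : Vec Bool k) → 0ℚ ≤ probSubset p A
    probSubset-nonNeg []          = 0≤1
    probSubset-nonNeg (true  ∷ A) = *-pres-0≤ 0≤p (probSubset-nonNeg A)
    probSubset-nonNeg (false ∷ A) = *-pres-0≤ 0≤1-p (probSubset-nonNeg A)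

    weightedSum-nonNeg : ∀ {k} (As : List (Vec Bool k)) {f} → (∀ A → 0ℚ ≤ f A) → 0ℚ ≤ weightedSum As f
    weightedSum-nonNeg []       0≤f = ≤-refl
    weightedSum-nonNeg (A ∷ As) 0≤f = +-pres-0≤ (*-pres-0≤ (probSubset-nonNeg A) (0≤f A)) (weightedSum-nonNeg As 0≤f)

    miss-nonNeg : ∀ {A : Set} (xs : List A) → 0ℚ ≤ miss xs
    miss-nonNeg []       = 0≤1
    miss-nonNeg (_ ∷ xs) = *-pres-0≤ 0≤1-p (miss-nonNeg xs)

    hit-nonNeg : ∀ {A : Set} (xs : List A) → 0ℚ ≤ hit xs
    hit-nonNeg []       = ≤-refl
    hit-nonNeg (_ ∷ xs) = subst (0ℚ ≤_) (hit-∷ p (miss xs)) (+-pres-0≤ 0≤p (*-pres-0≤ 0≤1-p (hit-nonNeg xs)))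
      where
      hit-∷ : ∀ p m → p + (1ℚ - p) * (1ℚ - m) ≡ 1ℚ - (1ℚ - p) * m
      hit-∷ = solve-∀ ℚ-ring

    hit≤p*length : ∀ {A : Set} (xs : List A) → hit xs ≤ p * lengthℚ xs
    hit≤p*length []       = ≤-reflexive (sym (*-zeroʳ p))
    hit≤p*length (_ ∷ xs) = 0≤q-p⇒p≤q (subst (0ℚ ≤_) (slack-∷ p (lengthℚ xs) (miss xs))
      (+-pres-0≤ (p≤q⇒0≤q-p (hit≤p*length xs)) (*-pres-0≤ 0≤p (hit-nonNeg xs))))
      where
      slack-∷ : ∀ p ℓ m → (p * ℓ - (1ℚ - m)) + p * (1ℚ - m) ≡ p * (1ℚ + ℓ) - (1ℚ - (1ℚ - p) * m)
      slack-∷ = solve-∀ ℚ-ring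

    length*p*miss≤hit : ∀ {A : Set} (xs : List A) → lengthℚ xs * p * miss xs ≤ hit xs
    length*p*miss≤hit []       = ≤-reflexive (trans (*-identityʳ (0ℚ * p)) (*-zeroˡ p))
    length*p*miss≤hit (_ ∷ xs) = 0≤q-p⇒p≤q (subst (0ℚ ≤_) (slack-∷ p (lengthℚ xs) (miss xs))
      (+-pres-0≤ (*-pres-0≤ 0≤1-p (p≤q⇒0≤q-p (length*p*miss≤hit xs)))
                 (*-pres-0≤ 0≤p (+-pres-0≤ (hit-nonNeg xs) (*-pres-0≤ 0≤p (miss-nonNeg xs))))))
      where
      slack-∷ : ∀ p ℓ m → (1ℚ - p) * ((1ℚ - m) - ℓ * p * m) + p * ((1ℚ - m) + p * m)
                     ≡ (1ℚ - (1ℚ - p) * m) - (1ℚ + ℓ) * p * ((1ℚ - p) * m)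
      slack-∷ = solve-∀ ℚ-ring

    hit-exchange : ∀ {A : Set} (xs ys : List A) → lengthℚ xs * hit ys * miss xs ≤ lengthℚ ys * hit xs
    hit-exchange xs ys = begin
      lengthℚ xs * hit ys * miss xs              ≤⟨ *-monoʳ-≤-nonNeg (miss xs) {{nonNegative (miss-nonNeg xs)}}
                                                     (*-monoˡ-≤-nonNeg (lengthℚ xs) {{nonNegative (lengthℚ-nonNeg xs)}}
                                                       (hit≤p*length ys)) ⟩
      lengthℚ xs * (p * lengthℚ ys) * miss xs    ≡⟨ regroup (lengthℚ xs) (lengthℚ ys) p (miss xs) ⟩
      lengthℚ ys * (lengthℚ xs * p * miss xs)    ≤⟨ *-monoˡ-≤-nonNeg (lengthℚ ys) {{nonNegative (lengthℚ-nonNeg ys)}}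
                                                     (length*p*miss≤hit xs) ⟩
      lengthℚ ys * hit xs                        ∎
      where
      open ≤-Reasoning
      regroup : ∀ s t p m → s * (p * t) * m ≡ t * (s * p * m)
      regroup = solve-∀ ℚ-ring

record Coefficients : Set where
  field
    base arrival₁ detour₁ arrival₂ delay detour₂ : ℚ

open Coefficients

twoBlockLatency : Coefficients → (x ex y ey : ℚ) → ℚ
twoBlockLatency κ x ex y ey =
  base κ + x * arrival₁ κ + ex * detour₁ κ + y * (arrival₂ κ + ex * delay κ) + ey * detour₂ κ

twoBlockLatency-regroup : ∀ κ x ex y ey → twoBlockLatency κ x ex y ey
  ≡ (base κ + y * arrival₂ κ + ey * detour₂ κ) + x * arrival₁ κ + ex * (detour₁ κ + y * delay κ)
twoBlockLatency-regroup κ = ring (base κ) (arrival₁ κ) (detour₁ κ) (arrival₂ κ) (delay κ) (detour₂ κ)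
  where
  ring : ∀ b a₁ d₁ a₂ δ d₂ x ex y ey → b + x * a₁ + ex * d₁ + y * (a₂ + ex * δ) + ey * d₂
                                     ≡ (b + y * a₂ + ey * d₂) + x * a₁ + ex * (d₁ + y * δ)
  ring = solve-∀ ℚ-ring

twoBlockLatency-noSecond : ∀ κ x ex → twoBlockLatency κ x ex 0ℚ 0ℚ ≡ base κ + x * arrival₁ κ + ex * detour₁ κ
twoBlockLatency-noSecond κ = ring (base κ) (arrival₁ κ) (detour₁ κ) (arrival₂ κ) (delay κ) (detour₂ κ)
  where
  ring : ∀ b a₁ d₁ a₂ δ d₂ x ex → b + x * a₁ + ex * d₁ + 0ℚ * (a₂ + ex * δ) + 0ℚ * d₂ ≡ b + x * a₁ + ex * d₁
  ring = solve-∀ ℚ-ring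

twoBlockLatency-noFirst : ∀ κ y ey → twoBlockLatency κ 0ℚ 0ℚ y ey ≡ base κ + y * arrival₂ κ + ey * detour₂ κ
twoBlockLatency-noFirst κ = ring (base κ) (arrival₁ κ) (detour₁ κ) (arrival₂ κ) (delay κ) (detour₂ κ)
  where
  ring : ∀ b a₁ d₁ a₂ δ d₂ y ey → b + 0ℚ * a₁ + 0ℚ * d₁ + y * (a₂ + 0ℚ * δ) + ey * d₂ ≡ b + y * a₂ + ey * d₂
  ring = solve-∀ ℚ-ring

relocation-gap : ∀ κ p s₁ s₂ m₁ m₂ →
  (s₁ + s₂) * twoBlockLatency κ (p * s₁) (1ℚ - m₁) (p * s₂) (1ℚ - m₂)
    - s₁ * twoBlockLatency κ (p * (s₁ + s₂)) (1ℚ - m₁ * m₂) 0ℚ 0ℚ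
    - s₂ * twoBlockLatency κ 0ℚ 0ℚ (p * (s₁ + s₂)) (1ℚ - m₁ * m₂)
  ≡ (s₂ * (1ℚ - m₁) - s₁ * (1ℚ - m₂) * m₁) * detour₁ κ
    + (s₁ * (1ℚ - m₂) - s₂ * (1ℚ - m₁) * m₂) * detour₂ κ
    + p * (1ℚ - m₁) * s₂ * (s₁ + s₂) * delay κ
relocation-gap κ = ring (base κ) (arrival₁ κ) (detour₁ κ) (arrival₂ κ) (delay κ) (detour₂ κ)
  where
  ring : ∀ b a₁ d₁ a₂ δ d₂ p s₁ s₂ m₁ m₂ →
    let G : ℚ → ℚ → ℚ → ℚ → ℚ
        G x ex y ey = b + x * a₁ + ex * d₁ + y * (a₂ + ex * δ) + ey * d₂
    in (s₁ + s₂) * G (p * s₁) (1ℚ - m₁) (p * s₂) (1ℚ - m₂)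
         - s₁ * G (p * (s₁ + s₂)) (1ℚ - m₁ * m₂) 0ℚ 0ℚ
         - s₂ * G 0ℚ 0ℚ (p * (s₁ + s₂)) (1ℚ - m₁ * m₂)
       ≡ (s₂ * (1ℚ - m₁) - s₁ * (1ℚ - m₂) * m₁) * d₁
         + (s₁ * (1ℚ - m₂) - s₂ * (1ℚ - m₁) * m₂) * d₂
         + p * (1ℚ - m₁) * s₂ * (s₁ + s₂) * δ
  ring = solve-∀ ℚ-ring

module Latency {m n : ℕ} (d : Fin m → Fin m → ℚ) (d-metric : IsMetric d) (loc : Fin n → Fin m) (r z : Fin m) where
  open Instance d loc r using (latFrom)
  open IsMetric d-metric using (nonneg; refl0; tri)

  pathLength : Fin m → List (Fin n) → ℚ
  pathLength c []       = 0ℚ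
  pathLength c (v ∷ vs) = d c (loc v) + pathLength (loc v) vs

  endpoint : Fin m → List (Fin n) → Fin m
  endpoint c []       = c
  endpoint c (v ∷ vs) = endpoint (loc v) vs

  AtZ : List (Fin n) → Set
  AtZ = All (λ v → loc v ≡ z)

  latFrom-++ : ∀ xs ys t c →
               latFrom t c (xs ++ ys) ≡ latFrom t c xs + latFrom (t + pathLength c xs) (endpoint c xs) ys
  latFrom-++ []       ys t c rewrite +-identityʳ t = sym (+-identityˡ _)
  latFrom-++ (v ∷ xs) ys t c
    rewrite latFrom-++ xs ys (t + d c (loc v)) (loc v) | +-assoc t (d c (loc v)) (pathLength (loc v) xs) =
    sym (+-assoc (t + d c (loc v)) _ _)

  latFrom-shift : ∀ ys t c → latFrom t c ys ≡ lengthℚ ys * t + latFrom 0ℚ c ys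
  latFrom-shift []       t c = sym (trans (+-identityʳ (0ℚ * t)) (*-zeroˡ t))
  latFrom-shift (v ∷ ys) t c
    rewrite latFrom-shift ys (t + d c (loc v)) (loc v) | latFrom-shift ys (0ℚ + d c (loc v)) (loc v) =
    shift t (d c (loc v)) (lengthℚ ys) (latFrom 0ℚ (loc v) ys)
    where
    shift : ∀ t x k L → t + x + (k * (t + x) + L) ≡ (1ℚ + k) * t + (0ℚ + x + (k * (0ℚ + x) + L))
    shift = solve-∀ ℚ-ring

  latFrom-AtZ : ∀ X t c → AtZ X → latFrom t c X ≡ lengthℚ X * (t + d c z)
  latFrom-AtZ []      t c []           = sym (*-zeroˡ (t + d c z))
  latFrom-AtZ (v ∷ X) t c (v∈z ∷ X∈z) rewrite v∈z | latFrom-AtZ X (t + d c z) z X∈z | refl0 z =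
    collect t (d c z) (lengthℚ X)
    where
    collect : ∀ t x k → t + x + k * (t + x + 0ℚ) ≡ (1ℚ + k) * (t + x)
    collect = solve-∀ ℚ-ring

  pathLength-AtZ : ∀ X c → AtZ X → pathLength c X ≡ nonEmptyℚ X * d c z
  pathLength-AtZ []      c []           = sym (*-zeroˡ (d c z))
  pathLength-AtZ (v ∷ X) c (v∈z ∷ X∈z) rewrite v∈z | pathLength-AtZ X z X∈z | refl0 z =
    trans (cong (d c z +_) (*-zeroʳ (nonEmptyℚ X))) (trans (+-identityʳ (d c z)) (sym (*-identityˡ (d c z))))

  endpoint-AtZ : ∀ (f : Fin m → ℚ) c X → AtZ X → f (endpoint c X) ≡ f c + nonEmptyℚ X * (f z - f c)
  endpoint-AtZ f c []      []           = sym (trans (cong (f c +_) (*-zeroˡ (f z - f c))) (+-identityʳ (f c)))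
  endpoint-AtZ f c (v ∷ X) (v∈z ∷ X∈z) rewrite v∈z | endpoint-AtZ f z X X∈z = jump (f c) (f z) (nonEmptyℚ X)
    where
    jump : ∀ a b e → b + e * (b - b) ≡ a + 1ℚ * (b - a)
    jump = solve-∀ ℚ-ring

  latFrom-block : ∀ X ys t c → AtZ X →
    latFrom t c (X ++ ys) ≡ lengthℚ X * (t + d c z) + latFrom (t + nonEmptyℚ X * d c z) (endpoint c X) ys
  latFrom-block X ys t c X∈z rewrite latFrom-++ X ys t c | latFrom-AtZ X t c X∈z | pathLength-AtZ X c X∈z = refl

  endpoint-nonEmpty : ∀ xs → xs ≢ [] → ∀ c c′ → endpoint c xs ≡ endpoint c′ xs
  endpoint-nonEmpty []       xs≢[] c c′ = ⊥-elim (xs≢[] refl)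
  endpoint-nonEmpty (_ ∷ _)  _     c c′ = refl

  latFrom-mono : ∀ ws {t c t′ c′} → (∀ x → t + d c x ≤ t′ + d c′ x) → latFrom t c ws ≤ latFrom t′ c′ ws
  latFrom-mono []       _      = ≤-refl
  latFrom-mono (v ∷ ws) earlier =
    +-mono-≤ (earlier (loc v)) (latFrom-mono ws (λ x → +-monoˡ-≤ (d (loc v) x) (earlier (loc v))))

  latFrom-detour : ∀ ys c → latFrom 0ℚ c ys ≤ lengthℚ ys * d c z + latFrom 0ℚ z ys
  latFrom-detour ys c = subst (latFrom 0ℚ c ys ≤_) (latFrom-shift ys (d c z) z) (latFrom-mono ys via-z)
    where
    via-z : ∀ x → 0ℚ + d c x ≤ d c z + d z x
    via-z x = subst (_≤ d c z + d z x) (sym (+-identityˡ (d c x))) (tri c z x)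

  pathLength-detour : ∀ ys c → pathLength c ys ≤ d c z + pathLength z ys
  pathLength-detour []       c = subst (0ℚ ≤_) (sym (+-identityʳ (d c z))) (nonneg c z)
  pathLength-detour (v ∷ ys) c = subst (d c (loc v) + pathLength (loc v) ys ≤_)
    (+-assoc (d c z) (d z (loc v)) (pathLength (loc v) ys))
    (+-monoˡ-≤ (pathLength (loc v) ys) (tri c z (loc v)))

  -- For the tour a′ ++ X ++ b′ ++ Y ++ c′ with X and Y at z: base is the latency of a′ ++ b′ ++ c′,
  -- arrivalᵢ the arrival time at z of the i-th block when the first block is empty, detourᵢ the
  -- extra latency that a nonempty i-th block causes for the vertices after it, and delay the extra
  -- arrival time that a nonempty first block causes for the second one.
  coefficients : (a′ b′ c′ : List (Fin n)) → Coefficients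
  coefficients a′ b′ c′ = record
    { base     = latFrom 0ℚ r a′ + lengthℚ b′ * T + latFrom 0ℚ P b′
                 + lengthℚ c′ * T + lengthℚ c′ * pathLength P b′ + latFrom 0ℚ Q c′
    ; arrival₁ = T + d P z
    ; detour₁  = lengthℚ b′ * d P z + (latFrom 0ℚ z b′ - latFrom 0ℚ P b′) + lengthℚ c′ * δ
    ; arrival₂ = T + pathLength P b′ + d Q z
    ; delay    = δ
    ; detour₂  = lengthℚ c′ * d Q z + (latFrom 0ℚ z c′ - latFrom 0ℚ Q c′)
    }
    where
    P Q : Fin m
    P = endpoint r a′
    Q = endpoint P b′
    T δ : ℚ
    T = pathLength r a′
    δ = d P z + (pathLength z b′ - pathLength P b′)

  twoBlock-latency : ∀ a′ b′ c′ X Y → b′ ≢ [] → AtZ X → AtZ Y →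
    latFrom 0ℚ r (a′ ++ X ++ b′ ++ Y ++ c′)
      ≡ twoBlockLatency (coefficients a′ b′ c′) (lengthℚ X) (nonEmptyℚ X) (lengthℚ Y) (nonEmptyℚ Y)
  twoBlock-latency a′ b′ c′ X Y b′≢[] X∈z Y∈z
    rewrite latFrom-++ a′ (X ++ b′ ++ Y ++ c′) 0ℚ r
          | latFrom-block X (b′ ++ Y ++ c′) (0ℚ + pathLength r a′) (endpoint r a′) X∈z
          | latFrom-++ b′ (Y ++ c′) (0ℚ + pathLength r a′ + nonEmptyℚ X * d (endpoint r a′) z)
                                    (endpoint (endpoint r a′) X)
          | latFrom-shift b′ (0ℚ + pathLength r a′ + nonEmptyℚ X * d (endpoint r a′) z)
                             (endpoint (endpoint r a′) X)
          | endpoint-nonEmpty b′ b′≢[] (endpoint (endpoint r a′) X) (endpoint r a′)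
          | latFrom-block Y c′ (0ℚ + pathLength r a′ + nonEmptyℚ X * d (endpoint r a′) z
                                  + pathLength (endpoint (endpoint r a′) X) b′)
                               (endpoint (endpoint r a′) b′) Y∈z
          | latFrom-shift c′ (0ℚ + pathLength r a′ + nonEmptyℚ X * d (endpoint r a′) z
                                + pathLength (endpoint (endpoint r a′) X) b′
                                + nonEmptyℚ Y * d (endpoint (endpoint r a′) b′) z)
                             (endpoint (endpoint (endpoint r a′) b′) Y)
          | endpoint-AtZ (λ c → latFrom 0ℚ c c′) (endpoint (endpoint r a′) b′) Y Y∈z
          | endpoint-AtZ (λ c → latFrom 0ℚ c b′) (endpoint r a′) X X∈z
          | endpoint-AtZ (λ c → pathLength c b′) (endpoint r a′) X X∈z
          = expand (latFrom 0ℚ r a′) (pathLength r a′) (d P z) (lengthℚ X) (nonEmptyℚ X)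
                   (lengthℚ b′) (latFrom 0ℚ P b′) (latFrom 0ℚ z b′) (pathLength P b′) (pathLength z b′)
                   (lengthℚ Y) (d Q z) (lengthℚ c′) (latFrom 0ℚ Q c′) (latFrom 0ℚ z c′) (nonEmptyℚ Y)
    where
    P Q : Fin m
    P = endpoint r a′
    Q = endpoint P b′
    expand : ∀ A T D x ex nb BP Bz LP Lz y E nc CQ Cz ey →
      A + (x * (0ℚ + T + D) + (nb * (0ℚ + T + ex * D) + (BP + ex * (Bz - BP))
        + (y * (0ℚ + T + ex * D + (LP + ex * (Lz - LP)) + E)
        + (nc * (0ℚ + T + ex * D + (LP + ex * (Lz - LP)) + ey * E) + (CQ + ey * (Cz - CQ))))))
      ≡ (A + nb * T + BP + nc * T + nc * LP + CQ) + x * (T + D) + ex * (nb * D + (Bz - BP) + nc * (D + (Lz - LP)))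
        + y * ((T + LP + E) + ex * (D + (Lz - LP))) + ey * (nc * E + (Cz - CQ))
    expand = solve-∀ ℚ-ring

  delay-nonNeg : ∀ a′ b′ c′ → 0ℚ ≤ delay (coefficients a′ b′ c′)
  delay-nonNeg a′ b′ c′ =
    subst (0ℚ ≤_) (+-assoc (d P z) (pathLength z b′) (- pathLength P b′)) (p≤q⇒0≤q-p (pathLength-detour b′ P))
    where
    P : Fin m
    P = endpoint r a′

  detour₁-nonNeg : ∀ a′ b′ c′ → 0ℚ ≤ detour₁ (coefficients a′ b′ c′)
  detour₁-nonNeg a′ b′ c′ = +-pres-0≤
    (subst (0ℚ ≤_) (+-assoc (lengthℚ b′ * d P z) (latFrom 0ℚ z b′) (- latFrom 0ℚ P b′)) (p≤q⇒0≤q-p (latFrom-detour b′ P)))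
    (*-pres-0≤ (lengthℚ-nonNeg c′) (delay-nonNeg a′ b′ c′))
    where
    P : Fin m
    P = endpoint r a′

  detour₂-nonNeg : ∀ a′ b′ c′ → 0ℚ ≤ detour₂ (coefficients a′ b′ c′)
  detour₂-nonNeg a′ b′ c′ =
    subst (0ℚ ≤_) (+-assoc (lengthℚ c′ * d Q z) (latFrom 0ℚ z c′) (- latFrom 0ℚ Q c′)) (p≤q⇒0≤q-p (latFrom-detour c′ Q))
    where
    Q : Fin m
    Q = endpoint (endpoint r a′) b′

  -- The factor nonEmptyℚ b′ accounts for b′ = [], where the three tours coincide.
  latency-gap : ∀ s₁ s₂ a′ b′ c′ X Y → AtZ X → AtZ Y →
    let G = twoBlockLatency (coefficients a′ b′ c′) in
    (s₁ + s₂) * latFrom 0ℚ r (a′ ++ X ++ b′ ++ Y ++ c′)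
      - s₁ * latFrom 0ℚ r (a′ ++ X ++ Y ++ b′ ++ c′)
      - s₂ * latFrom 0ℚ r (a′ ++ b′ ++ X ++ Y ++ c′)
    ≡ nonEmptyℚ b′ * ((s₁ + s₂) * G (lengthℚ X) (nonEmptyℚ X) (lengthℚ Y) (nonEmptyℚ Y)
                      - s₁ * G (lengthℚ (X ++ Y)) (nonEmptyℚ (X ++ Y)) 0ℚ 0ℚ
                      - s₂ * G 0ℚ 0ℚ (lengthℚ (X ++ Y)) (nonEmptyℚ (X ++ Y)))
  latency-gap s₁ s₂ a′ [] c′ X Y X∈z Y∈z = cancel s₁ s₂ (latFrom 0ℚ r (a′ ++ X ++ Y ++ c′))
    ((s₁ + s₂) * G (lengthℚ X) (nonEmptyℚ X) (lengthℚ Y) (nonEmptyℚ Y)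
      - s₁ * G (lengthℚ (X ++ Y)) (nonEmptyℚ (X ++ Y)) 0ℚ 0ℚ
      - s₂ * G 0ℚ 0ℚ (lengthℚ (X ++ Y)) (nonEmptyℚ (X ++ Y)))
    where
    G : ℚ → ℚ → ℚ → ℚ → ℚ
    G = twoBlockLatency (coefficients a′ [] c′)
    cancel : ∀ s₁ s₂ h w → (s₁ + s₂) * h - s₁ * h - s₂ * h ≡ 0ℚ * w
    cancel = solve-∀ ℚ-ring
  latency-gap s₁ s₂ a′ b′@(_ ∷ _) c′ X Y X∈z Y∈z
    = trans (cong₂ _-_ (cong₂ _-_ (cong ((s₁ + s₂) *_) (twoBlock-latency a′ b′ c′ X Y (λ ()) X∈z Y∈z))
                                  (cong (s₁ *_) merged-first))
                       (cong (s₂ *_) merged-second))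
            (sym (*-identityˡ _))
    where
    XY∈z : AtZ (X ++ Y)
    XY∈z = All.++⁺ X∈z Y∈z
    merged-first : latFrom 0ℚ r (a′ ++ X ++ Y ++ b′ ++ c′)
                 ≡ twoBlockLatency (coefficients a′ b′ c′) (lengthℚ (X ++ Y)) (nonEmptyℚ (X ++ Y)) 0ℚ 0ℚ
    merged-first = trans (cong (λ l → latFrom 0ℚ r (a′ ++ l)) (sym (++-assoc X Y (b′ ++ c′))))
                         (twoBlock-latency a′ b′ c′ (X ++ Y) [] (λ ()) XY∈z [])
    merged-second : latFrom 0ℚ r (a′ ++ b′ ++ X ++ Y ++ c′)
                  ≡ twoBlockLatency (coefficients a′ b′ c′) 0ℚ 0ℚ (lengthℚ (X ++ Y)) (nonEmptyℚ (X ++ Y))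
    merged-second = trans (cong (λ l → latFrom 0ℚ r (a′ ++ b′ ++ l)) (sym (++-assoc X Y c′)))
                          (twoBlock-latency a′ b′ c′ [] (X ++ Y) (λ ()) [] XY∈z)

  latFrom-colocated-↭ : ∀ {M N} → AtZ M → M ↭ N → ∀ ys t c → latFrom t c (M ++ ys) ≡ latFrom t c (N ++ ys)
  latFrom-colocated-↭ _               ↭.refl            ys t c = refl
  latFrom-colocated-↭ (_ ∷ M∈z)       (↭.prep v π)      ys t c =
    cong (t + d c (loc v) +_) (latFrom-colocated-↭ M∈z π ys _ _)
  latFrom-colocated-↭ (u∈z ∷ v∈z ∷ M∈z) (↭.swap u v π) ys t c rewrite u∈z | v∈z =
    cong (λ l → t + d c z + (t + d c z + d z z + l)) (latFrom-colocated-↭ M∈z π ys _ _)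
  latFrom-colocated-↭ M∈z             (↭.trans π₁ π₂)   ys t c =
    trans (latFrom-colocated-↭ M∈z π₁ ys t c) (latFrom-colocated-↭ (All-resp-↭ π₁ M∈z) π₂ ys t c)

  latFrom-swap : ∀ {X Y} → AtZ X → AtZ Y → ∀ ys t c → latFrom t c (X ++ Y ++ ys) ≡ latFrom t c (Y ++ X ++ ys)
  latFrom-swap {X} {Y} X∈z Y∈z ys t c = begin
    latFrom t c (X ++ Y ++ ys)    ≡⟨ cong (latFrom t c) (++-assoc X Y ys) ⟨
    latFrom t c ((X ++ Y) ++ ys)  ≡⟨ latFrom-colocated-↭ (All.++⁺ X∈z Y∈z) (++-comm X Y) ys t c ⟩
    latFrom t c ((Y ++ X) ++ ys)  ≡⟨ cong (latFrom t c) (++-assoc Y X ys) ⟩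
    latFrom t c (Y ++ X ++ ys)    ∎
    where open ≡-Reasoning

  latFrom-after : ∀ xs {ys ys′} → (∀ t c → latFrom t c ys ≡ latFrom t c ys′) →
                  ∀ t c → latFrom t c (xs ++ ys) ≡ latFrom t c (xs ++ ys′)
  latFrom-after []       ys≗ys′ = ys≗ys′
  latFrom-after (v ∷ xs) ys≗ys′ t c = cong (t + d c (loc v) +_) (latFrom-after xs ys≗ys′ _ _)

module Relocation {m n : ℕ} (d : Fin m → Fin m → ℚ) (d-metric : IsMetric d) (loc : Fin n → Fin m) (r : Fin m)
                  (p : ℚ) (0≤p : 0ℚ ≤ p) (p≤1 : p ≤ 1ℚ) (z : Fin m) where
  open Instance d loc r using (latFrom; LAT; ELAT)
  open Averaging p
  open Latency d d-metric loc r z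

  active-AtZ : ∀ A {X} → AtZ X → AtZ (active A X)
  active-AtZ A = All.filter⁺ (T? ∘ lookup A)

  LAT-split : ∀ A xs ys zs us vs → LAT A (xs ++ ys ++ zs ++ us ++ vs)
              ≡ latFrom 0ℚ r (active A xs ++ active A ys ++ active A zs ++ active A us ++ active A vs)
  LAT-split A xs ys zs us vs
    rewrite active-++ A xs (ys ++ zs ++ us ++ vs) | active-++ A ys (zs ++ us ++ vs)
          | active-++ A zs (us ++ vs) | active-++ A us vs = refl

  ELAT-swap : ∀ {X Y} → AtZ X → AtZ Y → ∀ xs ys zs →
              ELAT p (xs ++ ys ++ X ++ Y ++ zs) ≡ ELAT p (xs ++ ys ++ Y ++ X ++ zs)
  ELAT-swap {X} {Y} X∈z Y∈z xs ys zs = weightedSum-cong (allSubsets n) λ A → begin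
    LAT A (xs ++ ys ++ X ++ Y ++ zs)
      ≡⟨ LAT-split A xs ys X Y zs ⟩
    latFrom 0ℚ r (active A xs ++ active A ys ++ active A X ++ active A Y ++ active A zs)
      ≡⟨ latFrom-after (active A xs) (latFrom-after (active A ys)
           (latFrom-swap (active-AtZ A X∈z) (active-AtZ A Y∈z) (active A zs))) 0ℚ r ⟩
    latFrom 0ℚ r (active A xs ++ active A ys ++ active A Y ++ active A X ++ active A zs)
      ≡⟨ LAT-split A xs ys Y X zs ⟨
    LAT A (xs ++ ys ++ Y ++ X ++ zs) ∎
    where open ≡-Reasoning

  module _ (a b c C₁ C₂ : List (Fin n)) (τ-unique : Unique (a ++ C₁ ++ b ++ C₂ ++ c))
           (C₁∈z : AtZ C₁) (C₂∈z : AtZ C₂) where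

    s₁ s₂ : ℚ
    s₁ = lengthℚ C₁
    s₂ = lengthℚ C₂

    τ₀ τ₁ τ₂ : List (Fin n)
    τ₀ = a ++ C₁ ++ b ++ C₂ ++ c
    τ₁ = a ++ C₁ ++ C₂ ++ b ++ c
    τ₂ = a ++ b ++ C₁ ++ C₂ ++ c

    rearranged : τ₀ ↭ (C₁ ++ C₂) ++ a ++ b ++ c
    rearranged = begin
      a ++ C₁ ++ b ++ C₂ ++ c       ↭⟨ shifts a C₁ ⟩
      C₁ ++ a ++ b ++ C₂ ++ c       ≡⟨ cong (C₁ ++_) (++-assoc a b (C₂ ++ c)) ⟨
      C₁ ++ (a ++ b) ++ C₂ ++ c     ↭⟨ ++⁺ˡ C₁ (shifts (a ++ b) C₂) ⟩
      C₁ ++ C₂ ++ (a ++ b) ++ c     ≡⟨ cong (λ l → C₁ ++ C₂ ++ l) (++-assoc a b c) ⟩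
      C₁ ++ C₂ ++ a ++ b ++ c       ≡⟨ ++-assoc C₁ C₂ (a ++ b ++ c) ⟨
      (C₁ ++ C₂) ++ a ++ b ++ c     ∎
      where open PermutationReasoning

    blocks-separated : Unique (C₁ ++ C₂) × Unique (a ++ b ++ c) × Disjoint (C₁ ++ C₂) (a ++ b ++ c)
    blocks-separated = Unique-++⁻ (C₁ ++ C₂) (Unique-resp-↭ (setoid (Fin n)) (↭⇒↭ₛ rearranged) τ-unique)

    C₁₂-unique : Unique (C₁ ++ C₂)
    C₁₂-unique = proj₁ blocks-separated

    C₁-unique : Unique C₁
    C₁-unique = proj₁ (Unique-++⁻ C₁ C₁₂-unique)

    C₂-unique : Unique C₂
    C₂-unique = proj₁ (proj₂ (Unique-++⁻ C₁ C₁₂-unique))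

    C₂#C₁ : Disjoint C₂ C₁
    C₂#C₁ = Disjoint-sym (proj₂ (proj₂ (Unique-++⁻ C₁ C₁₂-unique)))

    outside : ∀ {v} → v ∈ C₁ ++ C₂ → v ∉ a ++ b ++ c
    outside v∈C v∈abc = proj₂ (proj₂ blocks-separated) (v∈C , v∈abc)

    κ : Vec Bool n → Coefficients
    κ A = coefficients (active A a) (active A b) (active A c)

    κ-invariant : ∀ {L} → L ⊆ C₁ ++ C₂ → Invariant L κ
    κ-invariant L⊆C v∈L bit A
      rewrite active-update a bit A (outside (L⊆C v∈L) ∘ ∈-++⁺ˡ)
            | active-update b bit A (outside (L⊆C v∈L) ∘ ∈-++⁺ʳ a ∘ ∈-++⁺ˡ)
            | active-update c bit A (outside (L⊆C v∈L) ∘ ∈-++⁺ʳ a ∘ ∈-++⁺ʳ b) = refl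

    b-invariant : Invariant (C₁ ++ C₂) (λ A → nonEmptyℚ (active A b))
    b-invariant v∈C bit A = cong nonEmptyℚ (active-update b bit A (outside v∈C ∘ ∈-++⁺ʳ a ∘ ∈-++⁺ˡ))

    gap : Vec Bool n → ℚ
    gap A = (s₁ + s₂) * LAT A τ₀ - s₁ * LAT A τ₁ - s₂ * LAT A τ₂

    G₀ G₁ G₂ : Vec Bool n → ℚ
    G₀ A = twoBlockLatency (κ A) (lengthℚ (active A C₁)) (nonEmptyℚ (active A C₁))
                                 (lengthℚ (active A C₂)) (nonEmptyℚ (active A C₂))
    G₁ A = twoBlockLatency (κ A) (lengthℚ (active A C₁ ++ active A C₂)) (nonEmptyℚ (active A C₁ ++ active A C₂)) 0ℚ 0ℚ
    G₂ A = twoBlockLatency (κ A) 0ℚ 0ℚ (lengthℚ (active A C₁ ++ active A C₂)) (nonEmptyℚ (active A C₁ ++ active A C₂))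

    gap-pointwise : ∀ A → gap A ≡ nonEmptyℚ (active A b) * ((s₁ + s₂) * G₀ A - s₁ * G₁ A - s₂ * G₂ A)
    gap-pointwise A =
      trans (cong₂ _-_ (cong₂ _-_ (cong ((s₁ + s₂) *_) (LAT-split A a C₁ b C₂ c))
                                  (cong (s₁ *_) (LAT-split A a C₁ C₂ b c)))
                       (cong (s₂ *_) (LAT-split A a b C₁ C₂ c)))
            (latency-gap s₁ s₂ (active A a) (active A b) (active A c) (active A C₁) (active A C₂)
                         (active-AtZ A C₁∈z) (active-AtZ A C₂∈z))

    average-G₀ : ∀ A → average (C₁ ++ C₂) G₀ A ≡ twoBlockLatency (κ A) (p * s₁) (hit C₁) (p * s₂) (hit C₂)
    average-G₀ A = begin
      average (C₁ ++ C₂) G₀ A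
        ≡⟨ average-++ C₁ C₂ G₀ A ⟩
      average C₁ (average C₂ G₀) A
        ≡⟨ average-cong C₁ (average-affine C₂ C₂-unique α₂-inv β₂-inv γ₂-inv (λ _ → refl)) A ⟩
      average C₁ (λ B → twoBlockLatency (κ B) (lengthℚ (active B C₁)) (nonEmptyℚ (active B C₁)) (p * s₂) (hit C₂)) A
        ≡⟨ average-affine C₁ C₁-unique α₁-inv β₁-inv γ₁-inv
             (λ B → twoBlockLatency-regroup (κ B) (lengthℚ (active B C₁)) (nonEmptyℚ (active B C₁)) (p * s₂) (hit C₂)) A ⟩
      (base (κ A) + (p * s₂) * arrival₂ (κ A) + hit C₂ * detour₂ (κ A))
        + (p * s₁) * arrival₁ (κ A) + hit C₁ * (detour₁ (κ A) + (p * s₂) * delay (κ A))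
        ≡⟨ twoBlockLatency-regroup (κ A) (p * s₁) (hit C₁) (p * s₂) (hit C₂) ⟨
      twoBlockLatency (κ A) (p * s₁) (hit C₁) (p * s₂) (hit C₂) ∎
      where
      open ≡-Reasoning
      κ-inv₁ : Invariant C₁ κ
      κ-inv₁ = κ-invariant ∈-++⁺ˡ
      κ-inv₂ : Invariant C₂ κ
      κ-inv₂ = κ-invariant (∈-++⁺ʳ C₁)
      C₁-inv₂ : Invariant C₂ (λ B → active B C₁)
      C₁-inv₂ = active-invariant C₂#C₁
      α₂-inv : Invariant C₂ (λ B → base (κ B) + lengthℚ (active B C₁) * arrival₁ (κ B)
                                   + nonEmptyℚ (active B C₁) * detour₁ (κ B))
      α₂-inv = Invariant-map₂ (λ κ′ X → base κ′ + lengthℚ X * arrival₁ κ′ + nonEmptyℚ X * detour₁ κ′) κ-inv₂ C₁-inv₂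
      β₂-inv : Invariant C₂ (λ B → arrival₂ (κ B) + nonEmptyℚ (active B C₁) * delay (κ B))
      β₂-inv = Invariant-map₂ (λ κ′ X → arrival₂ κ′ + nonEmptyℚ X * delay κ′) κ-inv₂ C₁-inv₂
      γ₂-inv : Invariant C₂ (λ B → detour₂ (κ B))
      γ₂-inv = Invariant-map detour₂ κ-inv₂
      α₁-inv : Invariant C₁ (λ B → base (κ B) + (p * s₂) * arrival₂ (κ B) + hit C₂ * detour₂ (κ B))
      α₁-inv = Invariant-map (λ κ′ → base κ′ + (p * s₂) * arrival₂ κ′ + hit C₂ * detour₂ κ′) κ-inv₁
      β₁-inv : Invariant C₁ (λ B → arrival₁ (κ B))
      β₁-inv = Invariant-map arrival₁ κ-inv₁
      γ₁-inv : Invariant C₁ (λ B → detour₁ (κ B) + (p * s₂) * delay (κ B))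
      γ₁-inv = Invariant-map (λ κ′ → detour₁ κ′ + (p * s₂) * delay κ′) κ-inv₁

    merged-length : p * lengthℚ (C₁ ++ C₂) ≡ p * (s₁ + s₂)
    merged-length = cong (p *_) (lengthℚ-++ C₁ C₂)

    merged-hit : hit (C₁ ++ C₂) ≡ 1ℚ - miss C₁ * miss C₂
    merged-hit = cong (λ m → 1ℚ - m) (miss-++ C₁ C₂)

    κ-field-invariant : ∀ (f : Coefficients → ℚ) → Invariant (C₁ ++ C₂) (f ∘ κ)
    κ-field-invariant f = Invariant-map f (κ-invariant id)

    average-G₁ : ∀ A → average (C₁ ++ C₂) G₁ A
                       ≡ twoBlockLatency (κ A) (p * (s₁ + s₂)) (1ℚ - miss C₁ * miss C₂) 0ℚ 0ℚ
    average-G₁ A = begin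
      average (C₁ ++ C₂) G₁ A
        ≡⟨ average-affine (C₁ ++ C₂) C₁₂-unique (κ-field-invariant base) (κ-field-invariant arrival₁) (κ-field-invariant detour₁) as-affine A ⟩
      base (κ A) + (p * lengthℚ (C₁ ++ C₂)) * arrival₁ (κ A) + hit (C₁ ++ C₂) * detour₁ (κ A)
        ≡⟨ twoBlockLatency-noSecond (κ A) (p * lengthℚ (C₁ ++ C₂)) (hit (C₁ ++ C₂)) ⟨
      twoBlockLatency (κ A) (p * lengthℚ (C₁ ++ C₂)) (hit (C₁ ++ C₂)) 0ℚ 0ℚ
        ≡⟨ cong₂ (λ x ex → twoBlockLatency (κ A) x ex 0ℚ 0ℚ) merged-length merged-hit ⟩
      twoBlockLatency (κ A) (p * (s₁ + s₂)) (1ℚ - miss C₁ * miss C₂) 0ℚ 0ℚ ∎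
      where
      open ≡-Reasoning
      as-affine : ∀ B → G₁ B ≡ base (κ B) + lengthℚ (active B (C₁ ++ C₂)) * arrival₁ (κ B)
                                           + nonEmptyℚ (active B (C₁ ++ C₂)) * detour₁ (κ B)
      as-affine B rewrite active-++ B C₁ C₂ =
        twoBlockLatency-noSecond (κ B) (lengthℚ (active B C₁ ++ active B C₂)) (nonEmptyℚ (active B C₁ ++ active B C₂))

    average-G₂ : ∀ A → average (C₁ ++ C₂) G₂ A
                       ≡ twoBlockLatency (κ A) 0ℚ 0ℚ (p * (s₁ + s₂)) (1ℚ - miss C₁ * miss C₂)
    average-G₂ A = begin
      average (C₁ ++ C₂) G₂ A
        ≡⟨ average-affine (C₁ ++ C₂) C₁₂-unique (κ-field-invariant base) (κ-field-invariant arrival₂) (κ-field-invariant detour₂) as-affine A ⟩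
      base (κ A) + (p * lengthℚ (C₁ ++ C₂)) * arrival₂ (κ A) + hit (C₁ ++ C₂) * detour₂ (κ A)
        ≡⟨ twoBlockLatency-noFirst (κ A) (p * lengthℚ (C₁ ++ C₂)) (hit (C₁ ++ C₂)) ⟨
      twoBlockLatency (κ A) 0ℚ 0ℚ (p * lengthℚ (C₁ ++ C₂)) (hit (C₁ ++ C₂))
        ≡⟨ cong₂ (twoBlockLatency (κ A) 0ℚ 0ℚ) merged-length merged-hit ⟩
      twoBlockLatency (κ A) 0ℚ 0ℚ (p * (s₁ + s₂)) (1ℚ - miss C₁ * miss C₂) ∎
      where
      open ≡-Reasoning
      as-affine : ∀ B → G₂ B ≡ base (κ B) + lengthℚ (active B (C₁ ++ C₂)) * arrival₂ (κ B)
                                           + nonEmptyℚ (active B (C₁ ++ C₂)) * detour₂ (κ B)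
      as-affine B rewrite active-++ B C₁ C₂ =
        twoBlockLatency-noFirst (κ B) (lengthℚ (active B C₁ ++ active B C₂)) (nonEmptyℚ (active B C₁ ++ active B C₂))

    average-gap : ∀ A → average (C₁ ++ C₂) gap A ≡ nonEmptyℚ (active A b) *
      ((s₁ + s₂) * average (C₁ ++ C₂) G₀ A - s₁ * average (C₁ ++ C₂) G₁ A - s₂ * average (C₁ ++ C₂) G₂ A)
    average-gap A = begin
      average (C₁ ++ C₂) gap A                                  ≡⟨ average-cong (C₁ ++ C₂) gap-pointwise A ⟩
      average (C₁ ++ C₂) (λ B → nonEmptyℚ (active B b) * H B) A ≡⟨ average-*ˡ (C₁ ++ C₂) H b-invariant A ⟩
      nonEmptyℚ (active A b) * average (C₁ ++ C₂) H A          ≡⟨ cong (nonEmptyℚ (active A b) *_) linear ⟩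
      nonEmptyℚ (active A b) *
        ((s₁ + s₂) * average (C₁ ++ C₂) G₀ A - s₁ * average (C₁ ++ C₂) G₁ A - s₂ * average (C₁ ++ C₂) G₂ A) ∎
      where
      open ≡-Reasoning
      H : Vec Bool n → ℚ
      H B = (s₁ + s₂) * G₀ B - s₁ * G₁ B - s₂ * G₂ B
      constant : ∀ c → Invariant (C₁ ++ C₂) (λ _ → c)
      constant c _ _ _ = refl
      linear : average (C₁ ++ C₂) H A
             ≡ (s₁ + s₂) * average (C₁ ++ C₂) G₀ A - s₁ * average (C₁ ++ C₂) G₁ A - s₂ * average (C₁ ++ C₂) G₂ A
      linear = trans (average-minus (C₁ ++ C₂) (λ B → (s₁ + s₂) * G₀ B - s₁ * G₁ B) (λ B → s₂ * G₂ B) A)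
        (cong₂ _-_ (trans (average-minus (C₁ ++ C₂) (λ B → (s₁ + s₂) * G₀ B) (λ B → s₁ * G₁ B) A)
                          (cong₂ _-_ (average-*ˡ (C₁ ++ C₂) G₀ (constant (s₁ + s₂)) A)
                                     (average-*ˡ (C₁ ++ C₂) G₁ (constant s₁) A)))
                   (average-*ˡ (C₁ ++ C₂) G₂ (constant s₂) A))

    average-gap-nonNeg : ∀ A → 0ℚ ≤ average (C₁ ++ C₂) gap A
    average-gap-nonNeg A = subst (0ℚ ≤_) (sym (trans (average-gap A) (cong (nonEmptyℚ b′ *_) weighted-detours)))
      (*-pres-0≤ (nonEmptyℚ-nonNeg b′)
        (+-pres-0≤ (+-pres-0≤ (*-pres-0≤ (p≤q⇒0≤q-p (hit-exchange 0≤p p≤1 C₁ C₂)) (detour₁-nonNeg a′ b′ c′))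
                              (*-pres-0≤ (p≤q⇒0≤q-p (hit-exchange 0≤p p≤1 C₂ C₁)) (detour₂-nonNeg a′ b′ c′)))
                   (*-pres-0≤ (*-pres-0≤ (*-pres-0≤ (*-pres-0≤ 0≤p (hit-nonNeg 0≤p p≤1 C₁)) (lengthℚ-nonNeg C₂))
                                         (+-pres-0≤ (lengthℚ-nonNeg C₁) (lengthℚ-nonNeg C₂)))
                              (delay-nonNeg a′ b′ c′))))
      where
      a′ b′ c′ : List (Fin n)
      a′ = active A a
      b′ = active A b
      c′ = active A c
      weighted-detours :
        (s₁ + s₂) * average (C₁ ++ C₂) G₀ A - s₁ * average (C₁ ++ C₂) G₁ A - s₂ * average (C₁ ++ C₂) G₂ A
        ≡ (s₂ * hit C₁ - s₁ * hit C₂ * miss C₁) * detour₁ (κ A) + (s₁ * hit C₂ - s₂ * hit C₁ * miss C₂) * detour₂ (κ A)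
          + p * hit C₁ * s₂ * (s₁ + s₂) * delay (κ A)
      weighted-detours =
        trans (cong₂ _-_ (cong₂ _-_ (cong ((s₁ + s₂) *_) (average-G₀ A)) (cong (s₁ *_) (average-G₁ A)))
                         (cong (s₂ *_) (average-G₂ A)))
              (relocation-gap (κ A) p s₁ s₂ (miss C₁) (miss C₂))

    weighted-relocation : lengthℚ C₁ * ELAT p (a ++ C₁ ++ C₂ ++ b ++ c) + lengthℚ C₂ * ELAT p (a ++ b ++ C₁ ++ C₂ ++ c)
                          ≤ (lengthℚ C₁ + lengthℚ C₂) * ELAT p (a ++ C₁ ++ b ++ C₂ ++ c)
    weighted-relocation = 0≤q-p⇒p≤q (subst (0ℚ ≤_) 𝔼-gap
      (subst (0ℚ ≤_) (sym (𝔼-average (C₁ ++ C₂) gap)) (weightedSum-nonNeg 0≤p p≤1 (allSubsets n) average-gap-nonNeg)))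
      where
      regroup : ∀ s₁ s₂ e₀ e₁ e₂ → (s₁ + s₂) * e₀ - s₁ * e₁ - s₂ * e₂ ≡ (s₁ + s₂) * e₀ - (s₁ * e₁ + s₂ * e₂)
      regroup = solve-∀ ℚ-ring
      𝔼-gap : 𝔼 gap ≡ (s₁ + s₂) * ELAT p τ₀ - (s₁ * ELAT p τ₁ + s₂ * ELAT p τ₂)
      𝔼-gap = trans (weightedSum-minus (allSubsets n) (λ A → (s₁ + s₂) * LAT A τ₀ - s₁ * LAT A τ₁) (λ A → s₂ * LAT A τ₂))
        (trans (cong₂ _-_ (trans (weightedSum-minus (allSubsets n) (λ A → (s₁ + s₂) * LAT A τ₀) (λ A → s₁ * LAT A τ₁))
                                 (cong₂ _-_ (weightedSum-*ˡ (allSubsets n) (s₁ + s₂) (λ A → LAT A τ₀))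
                                            (weightedSum-*ˡ (allSubsets n) s₁ (λ A → LAT A τ₁))))
                          (weightedSum-*ˡ (allSubsets n) s₂ (λ A → LAT A τ₂)))
               (regroup s₁ s₂ (ELAT p τ₀) (ELAT p τ₁) (ELAT p τ₂)))

lemma6 : (m n : ℕ) (d : Fin m → Fin m → ℚ) → IsMetric d →
         (loc : Fin n → Fin m) (r : Fin m) (p : ℚ) → 0ℚ ≤ p → p ≤ 1ℚ →
         (τ : List (Fin n)) → τ ↭ allFin n →
         (z : Fin m) (τi τj : List (Fin n)) → Instance.Relocations d loc r z τ τi τj →
         (Instance.ELAT d loc r p τi ⊓ Instance.ELAT d loc r p τj) ≤ Instance.ELAT d loc r p τ
lemma6 m n d d-metric loc r p 0≤p p≤1 τ τ↭ z τi τj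
       (a , b , c , Ci , Cj , inj₁ ((refl , Ci≢[] , Ci∈z , _) , (_ , _ , Cj∈z , _) , refl , refl)) =
  weighted-mean⇒⊓≤ (lengthℚ-nonNeg Ci) (lengthℚ-nonNeg Cj) (+-mono-<-≤ (lengthℚ-pos Ci Ci≢[]) (lengthℚ-nonNeg Cj))
    (weighted-relocation a b c Ci Cj (↭allFin⇒Unique τ↭) Ci∈z Cj∈z)
  where open Relocation d d-metric loc r p 0≤p p≤1 z
lemma6 m n d d-metric loc r p 0≤p p≤1 τ τ↭ z τi τj
       (a , b , c , Ci , Cj , inj₂ ((refl , Cj≢[] , Cj∈z , _) , (_ , _ , Ci∈z , _) , refl , refl)) =
  subst (_≤ ELAT p τ) (⊓-comm (ELAT p τj) (ELAT p τi))
    (weighted-mean⇒⊓≤ (lengthℚ-nonNeg Cj) (lengthℚ-nonNeg Ci) (+-mono-<-≤ (lengthℚ-pos Cj Cj≢[]) (lengthℚ-nonNeg Ci))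
      (subst₂ (λ x y → lengthℚ Cj * x + lengthℚ Ci * y ≤ (lengthℚ Cj + lengthℚ Ci) * ELAT p τ)
              (ELAT-swap Cj∈z Ci∈z a [] (b ++ c)) (ELAT-swap Cj∈z Ci∈z a b c)
              (weighted-relocation a b c Cj Ci (↭allFin⇒Unique τ↭) Cj∈z Ci∈z)))
  where
  open Relocation d d-metric loc r p 0≤p p≤1 z
  open Instance d loc r using (ELAT)
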